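{- For every integer $q\ge 3$ there exists an orientable sequence of order $2$ over $\mathbb{Z}_q$ with period $q(q-1)/2$ if $q$ is odd and period $q(q-2)/2$ if $q$ is even (these values being the maximum possible periods of an orientable sequence of order 2 over $\mathbb{Z}_q$).
   Context: Sequences are periodic with entries in $\mathbb{Z}_q$. For $S=(s_i)$ write $\mathbf{s}_n(i)=(s_i,\ldots,s_{i+n-1})$; for an $n$-tuple $\mathbf{u}$, $\mathbf{u}^R$ is its reverse. A periodic sequence of period $m$ is an $n$-window sequence if $\mathbf{s}_n(i)=\mathbf{s}_n(j)$ implies $i\equiv j\pmod m$; it is an orientable sequence of order $n$ if also $\mathbf{s}_n(i)\neq\mathbf{s}_n(j)^R$ for all $i,j$. The paper calls an orientable sequence of order 2 meeting the known upper bound on period (namely $q(q-1)/2$ for odd $q$ and $q(q-2)/2$ for even $q$) maximal. -}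

module Defs where

open import Data.Nat using (ℕ; zero; suc; _+_; _*_; _∸_; _/_; NonZero)
open import Data.Nat.DivMod using (_mod_)
open import Data.Fin using (Fin; toℕ)
open import Data.Vec using (Vec; tabulate; reverse)
open import Relation.Binary.PropositionalEquality using (_≡_; _≢_)

-- A periodic sequence of period m (m ≥ 1) over ℤ_q, given by one period
-- s_0, …, s_{m-1}; the entry s_i for arbitrary i is s (i mod m).
PeriodicSeq : (q m : ℕ) → Set
PeriodicSeq q m = Fin m → Fin q

window : ∀ {q m} .{{_ : NonZero m}} → PeriodicSeq q m → (n : ℕ) → Fin m → Vec (Fin q) n
window {m = m} s n i = tabulate λ k → s ((toℕ i + toℕ k) mod m)

IsWindowSeq : ∀ {q m} .{{_ : NonZero m}} → ℕ → PeriodicSeq q m → Set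
IsWindowSeq n s = ∀ i j → window s n i ≡ window s n j → i ≡ j

IsOrientable : ∀ {q m} .{{_ : NonZero m}} → ℕ → PeriodicSeq q m → Set
IsOrientable n s = IsWindowSeq n s × (∀ i j → window s n i ≢ reverse (window s n j))
  where open import Data.Product using (_×_)

maxPeriod2 : ℕ → ℕ
maxPeriod2 q with q Data.Nat.% 2
... | zero = (q * (q ∸ 2)) / 2
... | suc _ = (q * (q ∸ 1)) / 2

{-# OPTIONS --safe #-}
-- A window (a, b) and its reverse (b, a) name the same edge {a, b} of the complete graph on
-- ℤ_q, so an orientable sequence of order 2 is a closed walk without loops that traverses
-- every edge at most once; this is certified by a decoder sending each edge to its position.
-- The walk for p + 2 is the walk for p followed by a closed tour from 0 that interleaves
-- 0, 1, 2, … with p + 1, p, p + 1, p, … and, for odd p, ends with an extra p. The tour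
-- traverses each edge between {p, p + 1} and {0, …, p − 1} once, plus the edge {p, p + 1}
-- when p is odd. Starting from the empty walk for q ∈ {0, 1}, this uses all q(q − 1)/2 edges
-- for odd q, and all edges except a perfect matching, q(q − 2)/2 of them, for even q.
module Submission where

open import Defs
open import Data.Bool using (if_then_else_)
open import Data.Fin using (Fin; toℕ; fromℕ<)
open import Data.Fin.Properties using (toℕ-fromℕ<; toℕ<n; toℕ-injective)
open import Data.Nat
open import Data.Nat.DivMod using (_mod_; m%n<n; m<n⇒m%n≡m; n%n≡0; m*n/n≡m)
open import Data.Nat.Properties
open import Data.Nat.Tactic.RingSolver using (solve-∀)
open import Data.Product using (Σ; ∃-syntax; _×_; _,_)
open import Data.Sum using (_⊎_; inj₁; inj₂)
open import Data.Vec using (_∷_; []; reverse)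
open import Function using (_∘_; id)
open import Relation.Nullary using (Dec; does; ¬_; yes; no)
open import Relation.Nullary.Decidable using (dec-true; dec-false)
open import Relation.Binary.PropositionalEquality
open ≡-Reasoning

if-yes : ∀ {A P : Set} (P? : Dec P) {a b : A} → P → (if does P? then a else b) ≡ a
if-yes P? p rewrite dec-true P? p = refl

if-no : ∀ {A P : Set} (P? : Dec P) {a b : A} → ¬ P → (if does P? then a else b) ≡ b
if-no P? ¬p rewrite dec-false P? ¬p = refl

<-+-elim : ∀ (P : ℕ → Set) m n → (∀ i → i < m → P i) → (∀ t → t < n → P (m + t)) →
           ∀ i → i < m + n → P i
<-+-elim P m n below above i i<m+n with i <? m
... | yes i<m = below i i<m
... | no i≮m = subst P m+t≡i (above (i ∸ m) (+-cancelˡ-< m _ _ (subst (_< m + n) (sym m+t≡i) i<m+n)))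
  where
  m+t≡i : m + (i ∸ m) ≡ i
  m+t≡i = m+[n∸m]≡n (≮⇒≥ i≮m)

even-or-odd : ∀ t → (∃[ x ] t ≡ x + x) ⊎ (∃[ x ] t ≡ suc (x + x))
even-or-odd zero = inj₁ (0 , refl)
even-or-odd (suc t) with even-or-odd t
... | inj₁ (x , refl) = inj₂ (x , refl)
... | inj₂ (x , refl) = inj₁ (suc x , cong suc (sym (+-suc x x)))

n%2≡0⊎n%2≡1 : ∀ n → n % 2 ≡ 0 ⊎ n % 2 ≡ 1
n%2≡0⊎n%2≡1 zero = inj₁ refl
n%2≡0⊎n%2≡1 (suc zero) = inj₂ refl
n%2≡0⊎n%2≡1 (suc (suc n)) = n%2≡0⊎n%2≡1 n

[1+n]%2≢n%2 : ∀ n → suc n % 2 ≢ n % 2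
[1+n]%2≢n%2 zero ()
[1+n]%2≢n%2 (suc zero) ()
[1+n]%2≢n%2 (suc (suc n)) = [1+n]%2≢n%2 n

n%2≤1 : ∀ n → n % 2 ≤ 1
n%2≤1 n = s≤s⁻¹ (m%n<n n 2)

m+m<n+n⇒m<n : ∀ {m n} → m + m < n + n → m < n
m+m<n+n⇒m<n lt = ≰⇒> λ n≤m → <⇒≱ lt (+-mono-≤ n≤m n≤m)

m+m≤n+n⇒m≤n : ∀ {m n} → m + m ≤ n + n → m ≤ n
m+m≤n+n⇒m≤n le = ≮⇒≥ λ n<m → ≤⇒≯ le (+-mono-< n<m n<m)

⊓<⊔⇒≢ : ∀ {x y} → x ⊓ y < x ⊔ y → x ≢ y
⊓<⊔⇒≢ {x} lt refl = <-irrefl (trans (⊓-idem x) (sym (⊔-idem x))) lt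

module _ (P : ℕ → ℕ → Set) {x y : ℕ} where

  sort-≤ : x ≤ y → P x y → P (x ⊓ y) (x ⊔ y)
  sort-≤ x≤y = subst₂ P (sym (m≤n⇒m⊓n≡m x≤y)) (sym (m≤n⇒m⊔n≡n x≤y))

  sort-≥ : y ≤ x → P y x → P (x ⊓ y) (x ⊔ y)
  sort-≥ y≤x = subst₂ P (sym (m≥n⇒m⊓n≡n y≤x)) (sym (m≥n⇒m⊔n≡m y≤x))

next : ∀ {m} .{{_ : NonZero m}} → Fin m → Fin m
next {m} i = (toℕ i + 1) mod m

window₂ : ∀ {q m} .{{_ : NonZero m}} (s : PeriodicSeq q m) i → window s 2 i ≡ s i ∷ s (next i) ∷ []
window₂ {m = m} s i = cong (λ j → s j ∷ s (next i) ∷ []) (toℕ-injective (begin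
  toℕ ((toℕ i + 0) mod m)  ≡⟨ toℕ-fromℕ< _ ⟩
  (toℕ i + 0) % m          ≡⟨ cong (_% m) (+-identityʳ (toℕ i)) ⟩
  toℕ i % m                ≡⟨ m<n⇒m%n≡m (toℕ<n i) ⟩
  toℕ i                    ∎))

∷₂-injective : ∀ {A : Set} {a b c d : A} → a ∷ b ∷ [] ≡ c ∷ d ∷ [] → a ≡ c × b ≡ d
∷₂-injective refl = refl , refl

orientable₂-by-decoder : ∀ {q m} .{{_ : NonZero m}} (s : PeriodicSeq q m) (d : Fin q → Fin q → ℕ) →
  (∀ x y → d x y ≡ d y x) → (∀ i → s i ≢ s (next i)) → (∀ i → d (s i) (s (next i)) ≡ toℕ i) →
  IsOrientable 2 s
orientable₂-by-decoder s d d-sym loopless decodes = windowed , unreversed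
  where
  windowed : IsWindowSeq 2 s
  windowed i j wᵢ≡wⱼ with ∷₂-injective (trans (sym (window₂ s i)) (trans wᵢ≡wⱼ (window₂ s j)))
  ... | sᵢ≡sⱼ , sᵢ₊₁≡sⱼ₊₁ = toℕ-injective (begin
    toℕ i                 ≡⟨ decodes i ⟨
    d (s i) (s (next i))  ≡⟨ cong₂ d sᵢ≡sⱼ sᵢ₊₁≡sⱼ₊₁ ⟩
    d (s j) (s (next j))  ≡⟨ decodes j ⟩
    toℕ j                 ∎)

  unreversed : ∀ i j → window s 2 i ≢ reverse (window s 2 j)
  unreversed i j wᵢ≡wⱼᴿ
    with ∷₂-injective (trans (sym (window₂ s i)) (trans wᵢ≡wⱼᴿ (cong reverse (window₂ s j))))
  ... | sᵢ≡sⱼ₊₁ , sᵢ₊₁≡sⱼ = loopless i (trans sᵢ≡sⱼ₊₁ (cong (s ∘ next) (sym i≡j)))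
    where
    i≡j : i ≡ j
    i≡j = toℕ-injective (begin
      toℕ i                 ≡⟨ decodes i ⟨
      d (s i) (s (next i))  ≡⟨ cong₂ d sᵢ≡sⱼ₊₁ sᵢ₊₁≡sⱼ ⟩
      d (s (next j)) (s j)  ≡⟨ d-sym _ _ ⟩
      d (s j) (s (next j))  ≡⟨ decodes j ⟩
      toℕ j                 ∎)

record LabelledEdge (q : ℕ) (d : ℕ → ℕ → ℕ) (i lo hi : ℕ) : Set where
  constructor labelledEdge
  field
    lo<hi : lo < hi
    hi<q : hi < q
    label : d lo hi ≡ i

f[1+i%m]≡f[1+i] : ∀ {A : Set} (f : ℕ → A) m .{{_ : NonZero m}} → f m ≡ f 0 →
                ∀ {i} → i < m → f (suc i % m) ≡ f (suc i)
f[1+i%m]≡f[1+i] f m closed {i} i<m with m≤n⇒m<n∨m≡n i<m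
... | inj₁ 1+i<m = cong f (m<n⇒m%n≡m 1+i<m)
... | inj₂ refl = trans (cong f (n%n≡0 (suc i))) (sym closed)

orientable₂-from-closed-walk : ∀ {q m} .{{_ : NonZero m}} (f : ℕ → ℕ) (d : ℕ → ℕ → ℕ) → f m ≡ f 0 →
  (∀ i → i < m → LabelledEdge q d i (f i ⊓ f (suc i)) (f i ⊔ f (suc i))) →
  Σ (PeriodicSeq q m) (IsOrientable 2)
orientable₂-from-closed-walk {q} {m} f d closed edges = s , orientable₂-by-decoder s d′ d′-sym loopless decodes
  where
  open LabelledEdge

  s : PeriodicSeq q m
  s i = fromℕ< (≤-<-trans (m≤m⊔n _ _) (hi<q (edges (toℕ i) (toℕ<n i))))

  d′ : Fin q → Fin q → ℕ
  d′ x y = d (toℕ x ⊓ toℕ y) (toℕ x ⊔ toℕ y)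

  d′-sym : ∀ x y → d′ x y ≡ d′ y x
  d′-sym x y = cong₂ d (⊓-comm (toℕ x) (toℕ y)) (⊔-comm (toℕ x) (toℕ y))

  toℕ-s : ∀ i → toℕ (s i) ≡ f (toℕ i)
  toℕ-s i = toℕ-fromℕ< _

  toℕ-s-next : ∀ i → toℕ (s (next i)) ≡ f (suc (toℕ i))
  toℕ-s-next i = begin
    toℕ (s (next i))         ≡⟨ toℕ-s (next i) ⟩
    f (toℕ (next i))         ≡⟨ cong f (toℕ-fromℕ< _) ⟩
    f ((toℕ i + 1) % m)      ≡⟨ cong (λ k → f (k % m)) (+-comm (toℕ i) 1) ⟩
    f (suc (toℕ i) % m)      ≡⟨ f[1+i%m]≡f[1+i] f m closed (toℕ<n i) ⟩
    f (suc (toℕ i))          ∎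

  loopless : ∀ i → s i ≢ s (next i)
  loopless i sᵢ≡sᵢ₊₁ = ⊓<⊔⇒≢ (lo<hi (edges (toℕ i) (toℕ<n i)))
    (trans (sym (toℕ-s i)) (trans (cong toℕ sᵢ≡sᵢ₊₁) (toℕ-s-next i)))

  decodes : ∀ i → d′ (s i) (s (next i)) ≡ toℕ i
  decodes i rewrite toℕ-s i | toℕ-s-next i = label (edges (toℕ i) (toℕ<n i))

interleave : ∀ {A : Set} → (ℕ → A) → (ℕ → A) → ℕ → A
interleave f g zero = f 0
interleave f g (suc t) = interleave g (f ∘ suc) t

interleave-even : ∀ {A : Set} (f g : ℕ → A) x → interleave f g (x + x) ≡ f x
interleave-even f g zero = refl
interleave-even f g (suc x) rewrite +-suc x x = interleave-even (f ∘ suc) (g ∘ suc) x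

hub : ℕ → ℕ → ℕ
hub p x = p + suc x % 2

tour : ℕ → ℕ → ℕ
tour p = interleave id (hub p)

tourLength : ℕ → ℕ
tourLength p = p + p + p % 2

tour-even : ∀ p x → tour p (x + x) ≡ x
tour-even p = interleave-even id (hub p)

tour-odd : ∀ p x → tour p (suc (x + x)) ≡ hub p x
tour-odd p = interleave-even (hub p) suc

tour-even-suc : ∀ p x → tour p (suc (suc (x + x))) ≡ suc x
tour-even-suc p = interleave-even suc (hub p ∘ suc)

tour-last : ∀ y → tour (suc y) (tourLength (suc y) ∸ 1) ≡ suc y
tour-last y with n%2≡0⊎n%2≡1 (suc y)
... | inj₁ even = begin
  tour p (y + p + p % 2)  ≡⟨ cong (λ r → tour p (y + p + r)) even ⟩
  tour p (y + p + 0)      ≡⟨ cong (tour p) (trans (+-identityʳ (y + p)) (+-suc y y)) ⟩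
  tour p (suc (y + y))    ≡⟨ tour-odd p y ⟩
  p + p % 2               ≡⟨ cong (p +_) even ⟩
  p + 0                   ≡⟨ +-identityʳ p ⟩
  p                       ∎
  where p = suc y
... | inj₂ odd = begin
  tour p (y + p + p % 2)  ≡⟨ cong (λ r → tour p (y + p + r)) odd ⟩
  tour p (y + p + 1)      ≡⟨ cong (tour p) (+-comm (y + p) 1) ⟩
  tour p (p + p)          ≡⟨ tour-even p p ⟩
  p                       ∎
  where p = suc y

tourLength≤ : ∀ p → tourLength p ≤ suc (p + p)
tourLength≤ p = ≤-trans (+-monoʳ-≤ (p + p) (n%2≤1 p)) (≤-reflexive (+-comm (p + p) 1))

p≤hub : ∀ p x → p ≤ hub p x
p≤hub p x = m≤m+n p (suc x % 2)

hub≤1+p : ∀ p x → hub p x ≤ suc p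
hub≤1+p p x = ≤-trans (+-monoʳ-≤ p (n%2≤1 (suc x))) (≤-reflexive (+-comm p 1))

hub-alternates : ∀ p x → hub p (suc x) ≢ hub p x
hub-alternates p x = [1+n]%2≢n%2 (suc x) ∘ +-cancelˡ-≡ p _ _

below-hub : ∀ p x → suc (x + x) < tourLength p → x < hub p x
below-hub p x 2+2x≤L = <-≤-trans x<p (p≤hub p x)
  where
  x<p : x < p
  x<p = m+m<n+n⇒m<n (s≤s⁻¹ (≤-trans 2+2x≤L (tourLength≤ p)))

suc-below-hub : ∀ p x → suc x + suc x < tourLength p → suc x < hub p x
suc-below-hub p x lt with m≤n⇒m<n∨m≡n (m+m≤n+n⇒m≤n (s≤s⁻¹ (≤-trans lt (tourLength≤ p))))
... | inj₁ 1+x<p = <-≤-trans 1+x<p (p≤hub p x)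
-- here p = suc x, and p + p < tourLength p forces p to be odd, that is hub p x = p + 1
... | inj₂ refl = m<m+n p (+-cancelˡ-< (p + p) 0 (p % 2) (subst (_< tourLength p) (sym (+-identityʳ (p + p))) lt))

-- The edge {lo, hi} with hi ∈ {p, p + 1} is traversed at step lo + lo if hi = hub p lo, and
-- otherwise at the step before, which for lo = 0 is the closing step back to 0.
position : ℕ → ℕ → ℕ → ℕ
position p lo hi = if hi ≡ᵇ hub p lo then lo + lo else previous lo
  where
  previous : ℕ → ℕ
  previous zero = tourLength p ∸ 1
  previous (suc y) = suc (y + y)

TourEdge : ℕ → ℕ → ℕ → ℕ → Set
TourEdge p t lo hi = p ≤ hi × LabelledEdge (suc (suc p)) (position p) t lo hi

module _ (p : ℕ) where

  hub<2+p : ∀ x → hub p x < suc (suc p)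
  hub<2+p x = s≤s (hub≤1+p p x)

  even-step : ∀ x → x < hub p x → TourEdge p (x + x) x (hub p x)
  even-step x x<hub = p≤hub p x , labelledEdge x<hub (hub<2+p x) (if-yes (hub p x ≟ hub p x) refl)

  odd-step : ∀ x → suc x < hub p x → TourEdge p (suc (x + x)) (suc x) (hub p x)
  odd-step x 1+x<hub = p≤hub p x ,
    labelledEdge 1+x<hub (hub<2+p x) (if-no (hub p x ≟ hub p (suc x)) (hub-alternates p x ∘ sym))

  closing-step : 0 < p → TourEdge p (tourLength p ∸ 1) 0 p
  closing-step 0<p = ≤-refl , labelledEdge 0<p (s≤s (n≤1+n p)) (if-no (p ≟ hub p 0) (m+1+n≢m p ∘ sym))

-- Blocks and cycles are padded with their first vertex 0, so that entry suc t is the cyclic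
-- successor of entry t at every step t of the walk.
block : ℕ → ℕ → ℕ
block p t = if t <ᵇ tourLength p then tour p t else 0

block-inside : ∀ p {t} → t < tourLength p → block p t ≡ tour p t
block-inside p {t} = if-yes (t <? tourLength p)

block-end : ∀ p → block p (tourLength p) ≡ 0
block-end p = if-no (tourLength p <? tourLength p) (<-irrefl refl)

block-start : ∀ p → block p 0 ≡ 0
block-start zero = refl
block-start (suc p) = refl

tour-step : ∀ p t → suc t < tourLength p →
            TourEdge p t (tour p t ⊓ tour p (suc t)) (tour p t ⊔ tour p (suc t))
tour-step p t 1+t<L with even-or-odd t
... | inj₁ (x , refl) rewrite tour-even p x | tour-odd p x =
  sort-≤ (TourEdge p (x + x)) (<⇒≤ x<hub) (even-step p x x<hub)
  where
  x<hub : x < hub p x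
  x<hub = below-hub p x 1+t<L
... | inj₂ (x , refl) rewrite tour-odd p x | tour-even-suc p x =
  sort-≥ (TourEdge p (suc (x + x))) (<⇒≤ 1+x<hub) (odd-step p x 1+x<hub)
  where
  1+x<hub : suc x < hub p x
  1+x<hub = suc-below-hub p x (subst (_< tourLength p) (cong suc (sym (+-suc x x))) 1+t<L)

tour-closing-step : ∀ p t → suc t ≡ tourLength p → TourEdge p t (tour p t ⊓ 0) (tour p t ⊔ 0)
tour-closing-step (suc y) t 1+t≡L rewrite cong (_∸ 1) 1+t≡L | tour-last y =
  sort-≥ (TourEdge (suc y) _) z≤n (closing-step (suc y) z<s)

tour-edge : ∀ p t → t < tourLength p →
            TourEdge p t (block p t ⊓ block p (suc t)) (block p t ⊔ block p (suc t))
tour-edge p t t<L rewrite block-inside p t<L with m≤n⇒m<n∨m≡n t<L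
... | inj₁ 1+t<L rewrite block-inside p 1+t<L = tour-step p t 1+t<L
... | inj₂ 1+t≡L rewrite trans (cong (block p) 1+t≡L) (block-end p) =
  tour-closing-step p t 1+t≡L

cycleLength : ℕ → ℕ
cycleLength zero = 0
cycleLength (suc zero) = 0
cycleLength (suc (suc p)) = cycleLength p + tourLength p

cycle : ℕ → ℕ → ℕ
cycle zero _ = 0
cycle (suc zero) _ = 0
cycle (suc (suc p)) i = if i <ᵇ cycleLength p then cycle p i else block p (i ∸ cycleLength p)

decode : ℕ → ℕ → ℕ → ℕ
decode zero _ _ = 0
decode (suc zero) _ _ = 0
decode (suc (suc p)) lo hi = if hi <ᵇ p then decode p lo hi else cycleLength p + position p lo hi

cycle-tour : ∀ p t → cycle (suc (suc p)) (cycleLength p + t) ≡ block p t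
cycle-tour p t = trans (if-no (cycleLength p + t <? cycleLength p) (≤⇒≯ (m≤m+n _ t)))
                       (cong (block p) (m+n∸m≡n (cycleLength p) t))

cycle-end : ∀ q → cycle q (cycleLength q) ≡ 0
cycle-end zero = refl
cycle-end (suc zero) = refl
cycle-end (suc (suc p)) = trans (cycle-tour p (tourLength p)) (block-end p)

cycle-extends : ∀ p {i} → i ≤ cycleLength p → cycle (suc (suc p)) i ≡ cycle p i
cycle-extends p {i} i≤M with m≤n⇒m<n∨m≡n i≤M
... | inj₁ i<M = if-yes (i <? cycleLength p) i<M
... | inj₂ refl = begin
  cycle (suc (suc p)) (cycleLength p)      ≡⟨ cong (cycle (suc (suc p))) (+-identityʳ (cycleLength p)) ⟨
  cycle (suc (suc p)) (cycleLength p + 0)  ≡⟨ cycle-tour p 0 ⟩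
  block p 0                                ≡⟨ block-start p ⟩
  0                                        ≡⟨ cycle-end p ⟨
  cycle p (cycleLength p)                  ∎

cycle-start : ∀ q → cycle q 0 ≡ 0
cycle-start zero = refl
cycle-start (suc zero) = refl
cycle-start (suc (suc p)) = trans (cycle-extends p z≤n) (cycle-start p)

CycleEdge : ℕ → ℕ → Set
CycleEdge q i = LabelledEdge q (decode q) i (cycle q i ⊓ cycle q (suc i)) (cycle q i ⊔ cycle q (suc i))

edge-from-cycle : ∀ p {i lo hi} → LabelledEdge p (decode p) i lo hi →
                  LabelledEdge (suc (suc p)) (decode (suc (suc p))) i lo hi
edge-from-cycle p {hi = hi} (labelledEdge lo<hi hi<p label) =
  labelledEdge lo<hi (m<n⇒m<1+n (m<n⇒m<1+n hi<p)) (trans (if-yes (hi <? p) hi<p) label)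

edge-from-tour : ∀ p {t lo hi} → TourEdge p t lo hi →
                 LabelledEdge (suc (suc p)) (decode (suc (suc p))) (cycleLength p + t) lo hi
edge-from-tour p {hi = hi} (p≤hi , labelledEdge lo<hi hi<2+p label) =
  labelledEdge lo<hi hi<2+p (trans (if-no (hi <? p) (≤⇒≯ p≤hi)) (cong (cycleLength p +_) label))

cycle-edges : ∀ q i → i < cycleLength q → CycleEdge q i
cycle-edges (suc (suc p)) = <-+-elim (CycleEdge (suc (suc p))) (cycleLength p) (tourLength p) old new
  where
  old : ∀ i → i < cycleLength p → CycleEdge (suc (suc p)) i
  old i i<M rewrite cycle-extends p (<⇒≤ i<M) | cycle-extends p i<M = edge-from-cycle p (cycle-edges p i i<M)

  new : ∀ t → t < tourLength p → CycleEdge (suc (suc p)) (cycleLength p + t)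
  new t t<L rewrite cycle-tour p t | sym (+-suc (cycleLength p) t) | cycle-tour p (suc t) =
    edge-from-tour p (tour-edge p t t<L)

cycleLength-even : ∀ q → q % 2 ≡ 0 → cycleLength q * 2 ≡ q * (q ∸ 2)
cycleLength-even zero _ = refl
cycleLength-even (suc (suc zero)) _ = refl
cycleLength-even (suc (suc p@(suc (suc r)))) even = begin
  (cycleLength p + (p + p + p % 2)) * 2         ≡⟨ *-distribʳ-+ 2 (cycleLength p) (p + p + p % 2) ⟩
  cycleLength p * 2 + (p + p + p % 2) * 2       ≡⟨ cong₂ (λ a b → a + (p + p + b) * 2) (cycleLength-even p even) even ⟩
  p * r + (p + p + 0) * 2                       ≡⟨ algebra r ⟩
  (4 + r) * (2 + r)                             ∎
  where
  algebra : ∀ r → (2 + r) * r + ((2 + r) + (2 + r) + 0) * 2 ≡ (4 + r) * (2 + r)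
  algebra = solve-∀

cycleLength-odd : ∀ q → q % 2 ≡ 1 → cycleLength q * 2 ≡ q * (q ∸ 1)
cycleLength-odd (suc zero) _ = refl
cycleLength-odd (suc (suc p@(suc r))) odd = begin
  (cycleLength p + (p + p + p % 2)) * 2         ≡⟨ *-distribʳ-+ 2 (cycleLength p) (p + p + p % 2) ⟩
  cycleLength p * 2 + (p + p + p % 2) * 2       ≡⟨ cong₂ (λ a b → a + (p + p + b) * 2) (cycleLength-odd p odd) odd ⟩
  p * r + (p + p + 1) * 2                       ≡⟨ algebra r ⟩
  (3 + r) * (2 + r)                             ∎
  where
  algebra : ∀ r → (1 + r) * r + ((1 + r) + (1 + r) + 1) * 2 ≡ (3 + r) * (2 + r)
  algebra = solve-∀

maxPeriod2≡cycleLength : ∀ q → maxPeriod2 q ≡ cycleLength q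
maxPeriod2≡cycleLength q with q % 2 in parity | m%n<n q 2
... | 0 | _ = begin
  q * (q ∸ 2) / 2        ≡⟨ cong (_/ 2) (cycleLength-even q parity) ⟨
  cycleLength q * 2 / 2  ≡⟨ m*n/n≡m (cycleLength q) 2 ⟩
  cycleLength q          ∎
... | 1 | _ = begin
  q * (q ∸ 1) / 2        ≡⟨ cong (_/ 2) (cycleLength-odd q parity) ⟨
  cycleLength q * 2 / 2  ≡⟨ m*n/n≡m (cycleLength q) 2 ⟩
  cycleLength q          ∎
... | suc (suc _) | s≤s (s≤s ())

cycleLength-pos : ∀ {q} → 3 ≤ q → 0 < cycleLength q
cycleLength-pos {suc zero} (s≤s ())
cycleLength-pos {suc (suc zero)} (s≤s (s≤s ()))
cycleLength-pos {suc (suc p@(suc _))} _ = <-≤-trans z<s (m≤n+m (tourLength p) (cycleLength p))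

lemma1 : (q : ℕ) → 3 ≤ q →
    Σ (NonZero (maxPeriod2 q)) λ nz →
      Σ (PeriodicSeq q (maxPeriod2 q)) λ s → IsOrientable {{nz}} 2 s
lemma1 q 3≤q rewrite maxPeriod2≡cycleLength q =
  positive , orientable₂-from-closed-walk {{positive}} (cycle q) (decode q) closed (cycle-edges q)
  where
  positive : NonZero (cycleLength q)
  positive = >-nonZero (cycleLength-pos 3≤q)

  closed : cycle q (cycleLength q) ≡ cycle q 0
  closed = trans (cycle-end q) (sym (cycle-start q))
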